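{- Let $k\ge 2$ and let $C$ be a relaxed $k$-ary tree. Then $C$ is a compacted $k$-ary tree if and only if no two distinct internal nodes $u,v$ of $C$ have the same children in the same order. Moreover, if $C$ is not a compacted $k$-ary tree, then there exists a pair $(u,v)$ of distinct internal nodes with identical ordered children such that $v$ is a cherry and $u$ precedes $v$ in postorder.
   Context: An ordered DAG is a finite directed acyclic graph in which the outgoing edges of each node carry a left-to-right order (multiple edges allowed). A relaxed $k$-ary tree is an ordered DAG with a unique source and a unique sink in which every node other than the sink has out-degree exactly $k$. Internal nodes are all nodes except the sink. The spine is the spanning tree produced by depth-first search from the source (children visited left to right); its edges are internal edges, and all other edges are called pointers. Nodes are ordered in postorder along the spine. An internal node is a cherry if all its $k$ outgoing edges are pointers. For an internal node $u$, $T(u)$ denotes the ordered $k$-ary tree associated with $u$, obtained by unfolding the DAG below $u$ (the rooted ordered tree whose nodes correspond to directed paths starting at $u$, with the sink giving leaves). A compacted $k$-ary tree is a relaxed $k$-ary tree in which for any two distinct internal nodes $u,v$ the trees $T(u)$ and $T(v)$ are not identical. -}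

module Defs where

open import Data.Nat using (ℕ; zero; suc)
open import Data.Fin using (Fin)
open import Data.Fin.Properties using (_≟_)
open import Data.List using (List; []; _∷_; _++_; length)
open import Data.List.Membership.Propositional using (_∈_; _∉_)
open import Data.Product using (_×_; _,_; Σ; ∃; ∃-syntax; proj₁; proj₂)
open import Relation.Nullary using (¬_; yes; no)
open import Relation.Binary.PropositionalEquality using (_≡_; _≢_)
open import Relation.Binary.Construct.Closure.Transitive using (TransClosure)
import Data.List.Relation.Unary.Any as Any

-- Ordered DAGs: nodes are Fin N, and out u is the left-to-right ordered
-- list of targets of the outgoing edges of u (repetitions = multi-edges).

Edge : {N : ℕ} → (Fin N → List (Fin N)) → Fin N → Fin N → Set
Edge out u v = v ∈ out u

Acyclic : {N : ℕ} → (Fin N → List (Fin N)) → Set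
Acyclic {N} out = ∀ (u : Fin N) → ¬ TransClosure (Edge out) u u

record RelaxedTree (k : ℕ) : Set where
  field
    N       : ℕ
    out     : Fin N → List (Fin N)
    acyclic : Acyclic out
    source  : Fin N
    sink    : Fin N
    source-in     : ∀ u → source ∉ out u
    source-unique : ∀ v → (∀ u → v ∉ out u) → v ≡ source
    sink-out      : out sink ≡ []
    sink-unique   : ∀ v → out v ≡ [] → v ≡ sink
    degree        : ∀ v → v ≢ sink → length (out v) ≡ k

data Tree : Set where
  node : List Tree → Tree

module _ {k : ℕ} (C : RelaxedTree k) where
  open RelaxedTree C

  Internal : Fin N → Set
  Internal u = u ≢ sink

  -- A spine edge is recorded as (u , i): the i-th (0-based) outgoing
  -- edge of u.  Fuel N suffices since recursion depth is at most N.

  record DFSState : Set where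
    constructor st
    field
      visited : List (Fin N)
      post    : List (Fin N)
      spine   : List (Fin N × ℕ)

  mutual
    visit : ℕ → Fin N → DFSState → DFSState
    visit zero    u s = s
    visit (suc f) u (st vs ps sp) with visitKids f u 0 (out u) (st (u ∷ vs) ps sp)
    ... | st vs' ps' sp' = st vs' (ps' ++ (u ∷ [])) sp'

    visitKids : ℕ → Fin N → ℕ → List (Fin N) → DFSState → DFSState
    visitKids f u i []       s = s
    visitKids f u i (c ∷ cs) (st vs ps sp) with Any.any? (c ≟_) vs
    ... | yes _ = visitKids f u (suc i) cs (st vs ps sp)
    ... | no  _ = visitKids f u (suc i) cs (visit f c (st vs ps ((u , i) ∷ sp)))

  dfs : DFSState
  dfs = visit N source (st [] [] [])

  postorder : List (Fin N)
  postorder = DFSState.post dfs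

  spineEdges : List (Fin N × ℕ)
  spineEdges = DFSState.spine dfs

  Precedes : Fin N → Fin N → Set
  Precedes u v = ∃[ xs ] ∃[ ys ] ∃[ zs ] postorder ≡ xs ++ u ∷ ys ++ v ∷ zs

  Cherry : Fin N → Set
  Cherry u = Internal u × (∀ i → (u , i) ∉ spineEdges)

  mutual
    data Unfolds : Fin N → Tree → Set where
      unf-sink : Unfolds sink (node [])
      unf-int  : ∀ {u ts} → Internal u → UnfoldsAll (out u) ts → Unfolds u (node ts)

    data UnfoldsAll : List (Fin N) → List Tree → Set where
      []  : UnfoldsAll [] []
      _∷_ : ∀ {v vs t ts} → Unfolds v t → UnfoldsAll vs ts → UnfoldsAll (v ∷ vs) (t ∷ ts)

  SameUnfolding : Fin N → Fin N → Set
  SameUnfolding u v = ∃[ t ] (Unfolds u t × Unfolds v t)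

  Compacted : Set
  Compacted = ∀ u v → Internal u → Internal v → u ≢ v → ¬ SameUnfolding u v

  NoDuplicateChildren : Set
  NoDuplicateChildren = ∀ u v → Internal u → Internal v → u ≢ v → out u ≢ out v

-- T(u) is the node whose subtrees are the unfoldings of the ordered children
-- of u, and since k ≥ 1 only the sink unfolds to a single leaf.  Hence equal
-- children give equal unfoldings, and when no two internal nodes share their
-- children, u ↦ T(u) is injective by induction on the unfolding.
--
-- For the second part, order a pair of twins u, v (distinct internal nodes
-- with the same ordered children) along the postorder, say u before v.  When
-- the search follows a spine edge from v to a child c, c has not been visited
-- yet; hence every node that finishes before v and points to c is reached from
-- v.  u is such a node, so v reaches u, and as u and v have the same children
-- this closes a cycle.  So v carries no spine edge: it is a cherry.
module Submission where

open import Defs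
open import Data.Nat using (ℕ; zero; suc; _≤_; _+_; s≤s; z≤n)
open import Data.Nat.Properties
  using (≤-trans; ≤-reflexive; +-suc; +-monoʳ-≤; +-identityʳ; 1+n≰n; n≤1+n)
open import Data.Fin using (Fin)
open import Data.Fin.Properties using (_≟_; any?)
open import Data.Fin.Induction using (spo-wellFounded; spo-noetherian)
open import Data.List using (List; []; _∷_; _++_; length)
open import Data.List.Properties
  using (length-tabulate; length-removeAt′; ++-assoc; ∷-injective; ≡-dec)
open import Data.List.Membership.Propositional using (_∈_; _∉_; _─_)
open import Data.List.Membership.Propositional.Properties
  using (∈-allFin; ∈-∃++; ∈-++⁻; ∈-++⁺ˡ; ∈-++⁺ʳ)
open import Data.List.Relation.Binary.Subset.Propositional using (_⊆_)
open import Data.List.Relation.Unary.Any as Any using (here; there; index)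
open import Data.List.Relation.Unary.All as All using ()
open import Data.List.Relation.Unary.All.Properties using (¬Any⇒All¬)
open import Data.List.Relation.Unary.Unique.Propositional using (Unique; []; _∷_)
open import Data.Product using (_×_; _,_; ∃; ∃-syntax)
import Data.Product as Product
open import Data.Sum using (_⊎_; inj₁; inj₂)
import Data.Sum as Sum
open import Data.Empty using (⊥-elim)
open import Function using (_∘_; flip)
open import Function.Bundles using (_⇔_; mk⇔; Equivalence)
open import Induction.WellFounded using (Acc; acc; WellFounded; module Subrelation)
open import Relation.Nullary using (¬_; yes; no; Dec)
open import Relation.Nullary.Decidable using (¬?; _×-dec_)
open import Relation.Binary.Structures using (IsStrictPartialOrder)
open import Relation.Binary.PropositionalEquality
  using (_≡_; _≢_; refl; sym; trans; cong; cong₂; subst; resp₂; isEquivalence)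
open import Relation.Binary.Construct.Closure.Transitive as Plus
  using (TransClosure; [_]; _∷_)

module _ {a} {A : Set a} where

  ∈-─ : ∀ {xs : List A} {x z} (x∈xs : x ∈ xs) → z ∈ xs → z ≢ x → z ∈ xs ─ x∈xs
  ∈-─ (here refl) (here refl) z≢x = ⊥-elim (z≢x refl)
  ∈-─ (here refl) (there z∈xs) _ = z∈xs
  ∈-─ (there _) (here refl) _ = here refl
  ∈-─ (there x∈xs) (there z∈xs) z≢x = there (∈-─ x∈xs z∈xs z≢x)

  Unique-⊆⇒length≤ : ∀ {xs ys : List A} → Unique xs → xs ⊆ ys → length xs ≤ length ys
  Unique-⊆⇒length≤ [] _ = z≤n
  Unique-⊆⇒length≤ {x ∷ xs} {ys} (x∉xs ∷ xs!) xs⊆ys =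
    ≤-trans (s≤s (Unique-⊆⇒length≤ xs! xs⊆ys─x))
            (≤-reflexive (sym (length-removeAt′ ys (index x∈ys))))
    where
    x∈ys : x ∈ ys
    x∈ys = xs⊆ys (here refl)
    xs⊆ys─x : xs ⊆ ys ─ x∈ys
    xs⊆ys─x z∈xs = ∈-─ x∈ys (xs⊆ys (there z∈xs)) (λ { refl → All.lookup x∉xs z∈xs refl })

  Before : List A → A → A → Set a
  Before l x y = ∃[ xs ] ∃[ ys ] ∃[ zs ] l ≡ xs ++ x ∷ ys ++ y ∷ zs

  before⊎after : ∀ {l : List A} {x y} → x ∈ l → y ∈ l → x ≢ y → Before l x y ⊎ Before l y x
  before⊎after (here refl) (here refl) x≢y = ⊥-elim (x≢y refl)
  before⊎after {z ∷ _} (here refl) (there y∈l) _ =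
    let (ys , zs , eq) = ∈-∃++ y∈l in inj₁ ([] , ys , zs , cong (z ∷_) eq)
  before⊎after {z ∷ _} (there x∈l) (here refl) _ =
    let (ys , zs , eq) = ∈-∃++ x∈l in inj₂ ([] , ys , zs , cong (z ∷_) eq)
  before⊎after {z ∷ _} (there x∈l) (there y∈l) x≢y =
    Sum.map prepend prepend (before⊎after x∈l y∈l x≢y)
    where
    prepend : ∀ {l u v} → Before l u v → Before (z ∷ l) u v
    prepend (xs , ys , zs , eq) = z ∷ xs , ys , zs , cong (z ∷_) eq

  split-∷ʳ : ∀ (ps : List A) u xs x zs → ps ++ u ∷ [] ≡ xs ++ x ∷ zs →
             (∃[ zs′ ] ps ≡ xs ++ x ∷ zs′) ⊎ (xs ≡ ps × x ≡ u)
  split-∷ʳ [] u [] x zs refl = inj₂ (refl , refl)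
  split-∷ʳ [] u (_ ∷ []) x zs ()
  split-∷ʳ [] u (_ ∷ _ ∷ _) x zs ()
  split-∷ʳ (p ∷ ps) u [] x zs refl = inj₁ (ps , refl)
  split-∷ʳ (p ∷ ps) u (q ∷ xs) x zs eq with ∷-injective eq
  ... | refl , eq′ = Sum.map (Product.map₂ (cong (p ∷_))) (Product.map₁ (cong (p ∷_)))
                             (split-∷ʳ ps u xs x zs eq′)

Unique-length≤ : ∀ {n} {xs : List (Fin n)} → Unique xs → length xs ≤ n
Unique-length≤ {n} xs! =
  ≤-trans (Unique-⊆⇒length≤ xs! (λ {z} _ → ∈-allFin z))
          (≤-reflexive (length-tabulate {n = n} (λ i → i)))

module _ {k : ℕ} (C : RelaxedTree k) where
  open RelaxedTree C
  open DFSState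

  Reach⁺ : Fin N → Fin N → Set
  Reach⁺ = TransClosure (Edge out)

  Reach* : Fin N → Fin N → Set
  Reach* x y = x ≡ y ⊎ Reach⁺ x y

  edge-reach* : ∀ {u c y} → c ∈ out u → Reach* c y → Reach⁺ u y
  edge-reach* c∈u (inj₁ refl) = [ c∈u ]
  edge-reach* c∈u (inj₂ c⁺y) = c∈u ∷ c⁺y

  Reach⁺-isStrictPartialOrder : IsStrictPartialOrder _≡_ Reach⁺
  Reach⁺-isStrictPartialOrder = record
    { isEquivalence = isEquivalence
    ; irrefl = λ { refl → acyclic _ }
    ; trans = Plus.transitive (Edge out)
    ; <-resp-≈ = resp₂ Reach⁺
    }

  Edge-wellFounded : WellFounded (Edge out)
  Edge-wellFounded = Plus.wellFounded⁻ (Edge out) (spo-wellFounded Reach⁺-isStrictPartialOrder)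

  Edge-noetherian : WellFounded (flip (Edge out))
  Edge-noetherian = Subrelation.wellFounded [_] (spo-noetherian Reach⁺-isStrictPartialOrder)

  twin-unreachable : ∀ {u v} → out u ≡ out v → ¬ Reach⁺ v u
  twin-unreachable {u} same [ u∈v ] = acyclic u [ subst (u ∈_) (sym same) u∈v ]
  twin-unreachable {u} same (w∈v ∷ w⁺u) = acyclic u (subst (_ ∈_) (sym same) w∈v ∷ w⁺u)

  out-nonempty : 1 ≤ k → ∀ {u} → Internal C u → out u ≢ []
  out-nonempty k≥1 {u} iu empty with degree u iu
  ... | deg rewrite empty = 1+n≰n (subst (1 ≤_) (sym deg) k≥1)

  unfoldsAll : ∀ vs → (∀ {v} → v ∈ vs → ∃ (Unfolds C v)) → ∃ (UnfoldsAll C vs)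
  unfoldsAll [] _ = [] , []
  unfoldsAll (v ∷ vs) unf =
    let (t , ut) = unf (here refl)
        (ts , uts) = unfoldsAll vs (unf ∘ there)
    in t ∷ ts , ut ∷ uts

  unfolds : ∀ u → ∃ (Unfolds C u)
  unfolds u = go u (Edge-noetherian u)
    where
    go : ∀ u → Acc (flip (Edge out)) u → ∃ (Unfolds C u)
    go u (acc below) with u ≟ sink
    ... | yes refl = node [] , unf-sink
    ... | no iu = Product.map node (unf-int iu) (unfoldsAll (out u) (λ v∈u → go _ (below v∈u)))

  sameChildren⇒sameUnfolding : ∀ {u v} → Internal C u → Internal C v → out u ≡ out v →
                               SameUnfolding C u v
  sameChildren⇒sameUnfolding {u} iu iv same =
    let (ts , uts) = unfoldsAll (out u) (λ _ → unfolds _)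
    in node ts , unf-int iu uts , unf-int iv (subst (λ vs → UnfoldsAll C vs ts) same uts)

  UnfoldsAll-[] : ∀ {vs} → UnfoldsAll C vs [] → vs ≡ []
  UnfoldsAll-[] [] = refl

  mutual
    unfolds-injective : 1 ≤ k → NoDuplicateChildren C →
                        ∀ {u v t} → Unfolds C u t → Unfolds C v t → u ≡ v
    unfolds-injective _ _ unf-sink unf-sink = refl
    unfolds-injective k≥1 _ unf-sink (unf-int iv uts) =
      ⊥-elim (out-nonempty k≥1 iv (UnfoldsAll-[] uts))
    unfolds-injective k≥1 _ (unf-int iu uts) unf-sink =
      ⊥-elim (out-nonempty k≥1 iu (UnfoldsAll-[] uts))
    unfolds-injective k≥1 nd (unf-int {u} iu uts) (unf-int {v} iv vts) with u ≟ v
    ... | yes u≡v = u≡v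
    ... | no u≢v = ⊥-elim (nd u v iu iv u≢v (unfoldsAll-injective k≥1 nd uts vts))

    unfoldsAll-injective : 1 ≤ k → NoDuplicateChildren C →
                           ∀ {us vs ts} → UnfoldsAll C us ts → UnfoldsAll C vs ts → us ≡ vs
    unfoldsAll-injective _ _ [] [] = refl
    unfoldsAll-injective k≥1 nd (ut ∷ uts) (vt ∷ vts) =
      cong₂ _∷_ (unfolds-injective k≥1 nd ut vt) (unfoldsAll-injective k≥1 nd uts vts)

  compacted⇔noDuplicateChildren : 1 ≤ k → Compacted C ⇔ NoDuplicateChildren C
  compacted⇔noDuplicateChildren k≥1 = mk⇔
    (λ cp u v iu iv u≢v same → cp u v iu iv u≢v (sameChildren⇒sameUnfolding iu iv same))
    (λ nd u v iu iv u≢v (_ , ut , vt) → u≢v (unfolds-injective k≥1 nd ut vt))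

  Twins : Fin N → Fin N → Set
  Twins u v = Internal C u × Internal C v × u ≢ v × out u ≡ out v

  twins? : ∀ u v → Dec (Twins u v)
  twins? u v = ¬? (u ≟ sink) ×-dec ¬? (v ≟ sink) ×-dec ¬? (u ≟ v) ×-dec ≡-dec _≟_ (out u) (out v)

  ¬compacted⇒twins : 1 ≤ k → ¬ Compacted C → ∃[ u ] ∃[ v ] Twins u v
  ¬compacted⇒twins k≥1 ¬cp with any? (λ u → any? (twins? u))
  ... | yes twins = twins
  ... | no none = ⊥-elim (¬cp (Equivalence.from (compacted⇔noDuplicateChildren k≥1)
                                 (λ u v iu iv u≢v same → none (u , v , iu , iv , u≢v , same))))

  -- x has a child c (the target of its spine edge) that no node of ys points
  -- to unless it lies below x.
  Claims : Fin N → List (Fin N) → Set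
  Claims x ys = ∃[ c ] (c ∈ out x × (∀ {y} → y ∈ ys → c ∈ out y → Reach⁺ x y))

  fresh-claim : ∀ {x c ys} → c ∈ out x → (∀ {y} → y ∈ ys → c ∉ out y) → Claims x ys
  fresh-claim c∈x unreferenced = _ , c∈x , λ y∈ys c∈y → ⊥-elim (unreferenced y∈ys c∈y)

  claims-grow : ∀ {x ys ys′} → Claims x ys → (∀ {y} → y ∈ ys′ → y ∈ ys ⊎ Reach⁺ x y) → Claims x ys′
  claims-grow (c , c∈x , below) ys′⊆ =
    c , c∈x , λ y∈ys′ c∈y → Sum.fromInj₂ (λ y∈ys → below y∈ys c∈y) (ys′⊆ y∈ys′)

  SpineClaims : List (Fin N) → List (Fin N × ℕ) → Set
  SpineClaims ps sp = ∀ xs x zs i → ps ≡ xs ++ x ∷ zs → (x , i) ∈ sp → Claims x xs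

  StackClaims : Fin N → List (Fin N) → List (Fin N × ℕ) → Set
  StackClaims u ps sp = ∀ i → (u , i) ∈ sp → Claims u ps

  record Invariant (s : DFSState C) : Set where
    field
      visited-unique : Unique (visited s)
      post⊆visited   : post s ⊆ visited s
      post-closed    : ∀ {y c} → y ∈ post s → c ∈ out y → c ∈ visited s
      spine⊆visited  : ∀ {x i} → (x , i) ∈ spine s → x ∈ visited s
      spine-claims   : SpineClaims (post s) (spine s)

  record Grows (s s′ : DFSState C) : Set where
    field
      visited⊆    : visited s ⊆ visited s′
      post⊆       : post s ⊆ post s′
      visited-new : ∀ {y} → y ∈ visited s′ → y ∈ visited s ⊎ y ∈ post s′

  record VisitPost (u : Fin N) (s s′ : DFSState C) : Set where
    field
      invariant : Invariant s′
      grows     : Grows s s′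
      finished  : u ∈ post s′
      post-new  : ∀ {y} → y ∈ post s′ → y ∈ post s ⊎ Reach* u y
      spine-new : ∀ {x i} → (x , i) ∈ spine s′ → (x , i) ∈ spine s ⊎ x ∉ visited s
    open Invariant invariant public
    open Grows grows public

  record KidsPost (u : Fin N) (cs : List (Fin N)) (s s′ : DFSState C) : Set where
    field
      invariant    : Invariant s′
      grows        : Grows s s′
      kids-visited : cs ⊆ visited s′
      post-new     : ∀ {y} → y ∈ post s′ → y ∈ post s ⊎ Reach⁺ u y
      spine-new    : ∀ {x i} → (x , i) ∈ spine s′ → (x , i) ∈ spine s ⊎ (x ≡ u ⊎ x ∉ visited s)
      stack-claims : StackClaims u (post s′) (spine s′)
    open Grows grows public

  -- Each nested visit adds a fresh node to the duplicate-free visited list, so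
  -- the fuel N given to the search never runs out.
  Fuelled : ℕ → DFSState C → Set
  Fuelled f s = N ≤ f + length (visited s)

  fuelled-mono : ∀ f s s′ → Unique (visited s) → visited s ⊆ visited s′ → Fuelled f s → Fuelled f s′
  fuelled-mono f _ _ s! s⊆s′ fuel = ≤-trans fuel (+-monoʳ-≤ f (Unique-⊆⇒length≤ s! s⊆s′))

  out-of-fuel : ∀ {u s} → Invariant s → u ∉ visited s → ¬ Fuelled 0 s
  out-of-fuel inv u∉s fuel =
    1+n≰n (≤-trans (Unique-length≤ (¬Any⇒All¬ _ u∉s ∷ Invariant.visited-unique inv)) fuel)

  enter : Fin N → DFSState C → DFSState C
  enter u s = st (u ∷ visited s) (post s) (spine s)

  enter-invariant : ∀ {u s} → Invariant s → u ∉ visited s → Invariant (enter u s)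
  enter-invariant inv u∉s = record
    { visited-unique = ¬Any⇒All¬ _ u∉s ∷ visited-unique
    ; post⊆visited   = there ∘ post⊆visited
    ; post-closed    = λ y∈ c∈y → there (post-closed y∈ c∈y)
    ; spine⊆visited  = there ∘ spine⊆visited
    ; spine-claims   = spine-claims
    }
    where open Invariant inv

  finish-invariant : ∀ {u s s′} → KidsPost u (out u) (enter u s) s′ →
                     Invariant (st (visited s′) (post s′ ++ u ∷ []) (spine s′))
  finish-invariant {u} {s′ = s′} kp = record
    { visited-unique = visited-unique
    ; post⊆visited   = Sum.[ post⊆visited , (λ { (here refl) → visited⊆ (here refl) }) ] ∘ ∈-++⁻ (post s′)
    ; post-closed    = Sum.[ post-closed , (λ { (here refl) → kids-visited }) ] ∘ ∈-++⁻ (post s′)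
    ; spine⊆visited  = spine⊆visited
    ; spine-claims   = claims
    }
    where
    open KidsPost kp
    open Invariant invariant
    claims : SpineClaims (post s′ ++ u ∷ []) (spine s′)
    claims xs x zs i eq x∈sp with split-∷ʳ (post s′) u xs x zs eq
    ... | inj₁ (_ , eq′) = spine-claims xs x _ i eq′ x∈sp
    ... | inj₂ (refl , refl) = stack-claims i x∈sp

  finish-visit : ∀ {u s s′} → u ∉ visited s → KidsPost u (out u) (enter u s) s′ →
                 VisitPost u s (st (visited s′) (post s′ ++ u ∷ []) (spine s′))
  finish-visit {u} {s′ = s′} u∉s kp = record
    { invariant = finish-invariant kp
    ; grows = record
      { visited⊆    = visited⊆ ∘ there
      ; post⊆       = ∈-++⁺ˡ ∘ post⊆
      ; visited-new = λ y∈ → Sum.[ (λ { (here refl) → inj₂ u-finished ; (there y∈s) → inj₁ y∈s })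
                                 , inj₂ ∘ ∈-++⁺ˡ ] (visited-new y∈)
      }
    ; finished  = u-finished
    ; post-new  = λ y∈ → Sum.[ Sum.map₂ inj₂ ∘ post-new , (λ { (here refl) → inj₂ (inj₁ refl) }) ]
                            (∈-++⁻ (post s′) y∈)
    ; spine-new = λ x∈ → Sum.map₂ (Sum.[ (λ { refl → u∉s }) , (λ x∉ → x∉ ∘ there) ]) (spine-new x∈)
    }
    where
    open KidsPost kp
    u-finished : u ∈ post s′ ++ u ∷ []
    u-finished = ∈-++⁺ʳ (post s′) (here refl)

  tree-edge : Fin N → ℕ → DFSState C → DFSState C
  tree-edge u i s = st (visited s) (post s) ((u , i) ∷ spine s)

  tree-edge-invariant : ∀ {u i s} → Invariant s → u ∈ visited s → u ∉ post s →
                        Invariant (tree-edge u i s)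
  tree-edge-invariant {u} {i} {s} inv u∈s u∉post = record
    { visited-unique = visited-unique
    ; post⊆visited   = post⊆visited
    ; post-closed    = post-closed
    ; spine⊆visited  = λ { (here refl) → u∈s ; (there x∈sp) → spine⊆visited x∈sp }
    ; spine-claims   = claims
    }
    where
    open Invariant inv
    claims : SpineClaims (post s) ((u , i) ∷ spine s)
    claims xs x zs j eq (here refl) =
      ⊥-elim (u∉post (subst (u ∈_) (sym eq) (∈-++⁺ʳ xs (here refl))))
    claims xs x zs j eq (there x∈sp) = spine-claims xs x zs j eq x∈sp

  child-stackClaims : ∀ {u i c s s₁} → Invariant s → u ∈ visited s → c ∈ out u → c ∉ visited s →
                      StackClaims u (post s) (spine s) → VisitPost c (tree-edge u i s) s₁ →
                      StackClaims u (post s₁) (spine s₁)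
  child-stackClaims {u} {i} {s = s} inv u∈s c∈u c∉s claims vp j u∈sp
    with VisitPost.spine-new vp u∈sp
  ... | inj₂ u∉s = ⊥-elim (u∉s u∈s)
  ... | inj₁ u∈sp₀ = claims-grow (claim₀ u∈sp₀) (Sum.map₂ (edge-reach* c∈u) ∘ VisitPost.post-new vp)
    where
    claim₀ : (u , j) ∈ (u , i) ∷ spine s → Claims u (post s)
    claim₀ (here refl) = fresh-claim c∈u (λ y∈ c∈y → c∉s (Invariant.post-closed inv y∈ c∈y))
    claim₀ (there u∈sp′) = claims j u∈sp′

  kids-done : ∀ {u s} → Invariant s → StackClaims u (post s) (spine s) → KidsPost u [] s s
  kids-done inv claims = record
    { invariant = inv
    ; grows = record { visited⊆ = λ y∈ → y∈ ; post⊆ = λ y∈ → y∈ ; visited-new = inj₁ }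
    ; kids-visited = λ ()
    ; post-new = inj₁
    ; spine-new = inj₁
    ; stack-claims = claims
    }

  skip-visited : ∀ {u c cs s s′} → c ∈ visited s → KidsPost u cs s s′ → KidsPost u (c ∷ cs) s s′
  skip-visited c∈s kp = record
    { invariant = invariant
    ; grows = grows
    ; kids-visited = λ { (here refl) → visited⊆ c∈s ; (there c∈cs) → kids-visited c∈cs }
    ; post-new = post-new
    ; spine-new = spine-new
    ; stack-claims = stack-claims
    }
    where open KidsPost kp

  descend : ∀ {u i c cs s s₁ s₂} → c ∈ out u →
            VisitPost c (tree-edge u i s) s₁ → KidsPost u cs s₁ s₂ → KidsPost u (c ∷ cs) s s₂
  descend {u = u} {s = s} {s₁ = s₁} c∈u vp kp = record
    { invariant = KP.invariant
    ; grows = record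
      { visited⊆    = KP.visited⊆ ∘ VP.visited⊆
      ; post⊆       = KP.post⊆ ∘ VP.post⊆
      ; visited-new = λ y∈ → Sum.[ Sum.map₂ KP.post⊆ ∘ VP.visited-new , inj₂ ] (KP.visited-new y∈)
      }
    ; kids-visited = λ { (here refl) → KP.visited⊆ (VP.post⊆visited VP.finished)
                       ; (there c∈cs) → KP.kids-visited c∈cs }
    ; post-new = λ y∈ → Sum.[ Sum.map₂ (edge-reach* c∈u) ∘ VP.post-new , inj₂ ] (KP.post-new y∈)
    ; spine-new = λ x∈ → Sum.[ spine-new₁ , inj₂ ∘ Sum.map₂ (λ x∉s₁ → x∉s₁ ∘ VP.visited⊆) ]
                              (KP.spine-new x∈)
    ; stack-claims = KP.stack-claims
    }
    where
    module VP = VisitPost vp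
    module KP = KidsPost kp
    spine-new₁ : ∀ {x j} → (x , j) ∈ spine s₁ → (x , j) ∈ spine s ⊎ (x ≡ u ⊎ x ∉ visited s)
    spine-new₁ x∈ with VP.spine-new x∈
    ... | inj₁ (here refl) = inj₂ (inj₁ refl)
    ... | inj₁ (there x∈s) = inj₁ x∈s
    ... | inj₂ x∉s = inj₂ (inj₂ x∉s)

  mutual
    visit-spec : ∀ f u s → Invariant s → u ∉ visited s → Fuelled f s → VisitPost u s (visit C f u s)
    visit-spec zero u s inv u∉s fuel = ⊥-elim (out-of-fuel inv u∉s fuel)
    visit-spec (suc f) u s inv u∉s fuel
      with visitKids C f u 0 (out u) (enter u s)
         | kids-spec f u 0 (out u) (enter u s) (enter-invariant inv u∉s) (here refl)
             (u∉s ∘ Invariant.post⊆visited inv)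
             (λ _ u∈sp → ⊥-elim (u∉s (Invariant.spine⊆visited inv u∈sp)))
             (λ c∈u → c∈u) (subst (N ≤_) (sym (+-suc f _)) fuel)
    ... | _ | kp = finish-visit u∉s kp

    kids-spec : ∀ f u i cs s → Invariant s → u ∈ visited s → u ∉ post s →
                StackClaims u (post s) (spine s) → cs ⊆ out u → Fuelled f s →
                KidsPost u cs s (visitKids C f u i cs s)
    kids-spec f u i [] s inv _ _ claims _ _ = kids-done inv claims
    kids-spec f u i (c ∷ cs) s inv u∈s u∉post claims cs⊆u fuel with Any.any? (c ≟_) (visited s)
    ... | yes c∈s =
          skip-visited c∈s (kids-spec f u (suc i) cs s inv u∈s u∉post claims (cs⊆u ∘ there) fuel)
    ... | no c∉s = descend c∈u vp
          (kids-spec f u (suc i) cs s₁ VP.invariant (VP.visited⊆ u∈s) u∉post₁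
            (child-stackClaims inv u∈s c∈u c∉s claims vp) (cs⊆u ∘ there)
            (fuelled-mono f s s₁ (Invariant.visited-unique inv) VP.visited⊆ fuel))
      where
      c∈u : c ∈ out u
      c∈u = cs⊆u (here refl)
      s₁ : DFSState C
      s₁ = visit C f c (tree-edge u i s)
      vp : VisitPost c (tree-edge u i s) s₁
      vp = visit-spec f c (tree-edge u i s) (tree-edge-invariant inv u∈s u∉post) c∉s fuel
      module VP = VisitPost vp
      u∉post₁ : u ∉ post s₁
      u∉post₁ u∈ = Sum.[ u∉post , acyclic u ∘ edge-reach* c∈u ] (VP.post-new u∈)

  dfs-spec : VisitPost source (st [] [] []) (dfs C)
  dfs-spec = visit-spec N source (st [] [] []) initial (λ ()) (≤-reflexive (sym (+-identityʳ N)))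
    where
    initial : Invariant (st [] [] [])
    initial = record
      { visited-unique = []
      ; post⊆visited = λ ()
      ; post-closed = λ ()
      ; spine⊆visited = λ ()
      ; spine-claims = λ { [] _ _ _ () _ ; (_ ∷ _) _ _ _ () _ }
      }

  open VisitPost dfs-spec using (finished; visited-new; post-closed; spine-claims)

  postorder-complete : ∀ w → w ∈ postorder C
  postorder-complete w = go w (Edge-wellFounded w)
    where
    go : ∀ w → Acc (Edge out) w → w ∈ postorder C
    go w (acc above) with any? (λ y → Any.any? (w ≟_) (out y))
    ... | yes (y , w∈y) = Sum.fromInj₂ (λ ()) (visited-new (post-closed (go y (above w∈y)) w∈y))
    ... | no orphan with source-unique w (λ y w∈y → orphan (y , w∈y))
    ...   | refl = finished

  later-twin-is-cherry : ∀ {u v} → Internal C v → out u ≡ out v → Precedes C u v → Cherry C v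
  later-twin-is-cherry {u} {v} iv same (xs , ys , zs , eq) = iv , no-spine-edge
    where
    no-spine-edge : ∀ i → (v , i) ∉ spineEdges C
    no-spine-edge i v∈sp
      with spine-claims (xs ++ u ∷ ys) v zs i (trans eq (sym (++-assoc xs (u ∷ ys) (v ∷ zs)))) v∈sp
    ... | c , c∈v , below =
      twin-unreachable same (below (∈-++⁺ʳ xs (here refl)) (subst (c ∈_) (sym same) c∈v))

  ¬compacted⇒cherry-twins : 1 ≤ k → ¬ Compacted C →
    ∃[ u ] ∃[ v ] (Internal C u × Internal C v × u ≢ v × out u ≡ out v ×
                   Cherry C v × Precedes C u v)
  ¬compacted⇒cherry-twins k≥1 ¬cp with ¬compacted⇒twins k≥1 ¬cp
  ... | a , b , ia , ib , a≢b , same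
    with before⊎after (postorder-complete a) (postorder-complete b) a≢b
  ...   | inj₁ a≺b = a , b , ia , ib , a≢b , same , later-twin-is-cherry ib same a≺b , a≺b
  ...   | inj₂ b≺a = b , a , ib , ia , a≢b ∘ sym , sym same , later-twin-is-cherry ia (sym same) b≺a , b≺a

theorem2 : (k : ℕ) → 2 ≤ k → (C : RelaxedTree k) →
    (Compacted C ⇔ NoDuplicateChildren C) ×
    (¬ Compacted C →
      ∃[ u ] ∃[ v ] (Internal C u × Internal C v × u ≢ v ×
        RelaxedTree.out C u ≡ RelaxedTree.out C v ×
        Cherry C v × Precedes C u v))
theorem2 k k≥2 C = compacted⇔noDuplicateChildren C k≥1 , ¬compacted⇒cherry-twins C k≥1
  where
  k≥1 : 1 ≤ k
  k≥1 = ≤-trans (n≤1+n 1) k≥2
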